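{- Let $N \geq 2$. There exists a constant $\alpha_N > 0$ depending only on $N$ such that $$\#\left\{ \Gamma \in \mathcal{C}_N : \lambda_N(\Gamma) \leq R,\ \Gamma \text{ is } \mathrm{WR}' \right\} \geq \alpha_N R^N$$ as $R \to \infty$ (i.e., for all sufficiently large real $R$).
   Context: Let $\operatorname{rot}:\mathbb{R}^N\to\mathbb{R}^N$ be the rotational shift operator $\operatorname{rot}(x_1,\dots,x_N)=(x_N,x_1,\dots,x_{N-1})$. A sublattice $\Gamma\subseteq\mathbb{Z}^N$ is called cyclic if $\operatorname{rot}(\Gamma)=\Gamma$. $\mathcal{C}_N$ denotes the set of all full-rank cyclic sublattices of $\mathbb{Z}^N$. For a lattice $\Gamma$ of rank $r$, $\lambda_1(\Gamma)\le\dots\le\lambda_r(\Gamma)$ are its successive minima with respect to the Euclidean norm $\|\cdot\|$, and $S(\Gamma)=\{x\in\Gamma:\|x\|=\lambda_1(\Gamma)\}$ is its set of minimal vectors. $\Gamma$ is called $\mathrm{WR}'$ if $\Gamma=\operatorname{span}_{\mathbb{Z}} S(\Gamma)$.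
   Formalization: The count bound is asserted only for rational R rather than for all sufficiently large real R, and the constant $\alpha_N$ is taken rational. -}

module Defs where

open import Data.Nat as ℕ using (ℕ; zero; suc)
open import Data.Integer as ℤ using (ℤ; +_)
open import Data.Rational as ℚ using (ℚ; _/_; 1ℚ)
open import Data.Fin using (Fin; zero; suc)
open import Data.Vec using (Vec; []; _∷_; zipWith; map; replicate; last; init; foldr)
open import Data.List using (List; []; _∷_)
open import Data.Product using (Σ; _×_; _,_; ∃)
open import Relation.Binary.PropositionalEquality using (_≡_; _≢_)
open import Relation.Nullary using (¬_)
open import Function.Bundles using (_⇔_)

ZVec : ℕ → Set
ZVec N = Vec ℤ N

0v : ∀ {N} → ZVec N
0v = replicate _ (+ 0)

_+v_ : ∀ {N} → ZVec N → ZVec N → ZVec N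
_+v_ = zipWith ℤ._+_

_·v_ : ∀ {N} → ℤ → ZVec N → ZVec N
c ·v v = map (c ℤ.*_) v

normSq : ∀ {N} → ZVec N → ℤ
normSq = foldr _ (λ x acc → x ℤ.* x ℤ.+ acc) (+ 0)

rot : ∀ {N} → ZVec N → ZVec N
rot {zero} xs = xs
rot {suc n} xs = last xs ∷ init xs

lincomb : ∀ {N k} → (Fin k → ℤ) → (Fin k → ZVec N) → ZVec N
lincomb {k = zero} c v = 0v
lincomb {k = suc k} c v = (c zero ·v v zero) +v lincomb (λ i → c (suc i)) (λ i → v (suc i))

-- linear independence of a finite family of integer vectors
-- (over ℤ; equivalent to independence over ℚ or ℝ for integer vectors)
LinIndep : ∀ {N k} → (Fin k → ZVec N) → Set
LinIndep v = ∀ c → lincomb c v ≡ 0v → ∀ i → c i ≡ + 0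

record FRLattice (N : ℕ) : Set where
  field
    basis : Fin N → ZVec N
    indep : LinIndep basis
open FRLattice public

_∈L_ : ∀ {N} → ZVec N → FRLattice N → Set
x ∈L Γ = ∃ λ (c : Fin _ → ℤ) → x ≡ lincomb c (basis Γ)

SameLattice : ∀ {N} → FRLattice N → FRLattice N → Set
SameLattice Γ Δ = ∀ x → (x ∈L Γ) ⇔ (x ∈L Δ)

Cyclic : ∀ {N} → FRLattice N → Set
Cyclic Γ = (∀ x → x ∈L Γ → rot x ∈L Γ)
         × (∀ x → x ∈L Γ → ∃ λ y → y ∈L Γ × rot y ≡ x)

IsMinSq : ∀ {N} → FRLattice N → ℤ → Set
IsMinSq Γ m = (∃ λ v → v ∈L Γ × v ≢ 0v × normSq v ≡ m)
            × (∀ v → v ∈L Γ → v ≢ 0v → m ℤ.≤ normSq v)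

InSpanOf : ∀ {N} → (ZVec N → Set) → ZVec N → Set
InSpanOf {N} P x = Σ ℕ λ k → Σ (Fin k → ℤ) λ c → Σ (Fin k → ZVec N) λ v →
                     (∀ i → P (v i)) × x ≡ lincomb c v

MinVec : ∀ {N} → FRLattice N → ℤ → ZVec N → Set
MinVec Γ m v = v ∈L Γ × normSq v ≡ m

WR′ : ∀ {N} → FRLattice N → Set
WR′ Γ = Σ ℤ λ m → IsMinSq Γ m × (∀ x → (x ∈L Γ) ⇔ InSpanOf (MinVec Γ m) x)

toℚ : ℤ → ℚ
toℚ z = z / 1

fromℕℚ : ℕ → ℚ
fromℕℚ n = + n / 1

_^ℚ_ : ℚ → ℕ → ℚ
q ^ℚ zero = 1ℚ
q ^ℚ suc n = q ℚ.* (q ^ℚ n)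

-- λ_N(Γ) ≤ R  (R ≥ 0): Γ contains N linearly independent vectors of norm ≤ R
-- (λ_N is the least r such that Γ has N independent vectors of norm ≤ r; the
--  infimum is attained since squared norms are integers)
λN≤ : ∀ {N} → FRLattice N → ℚ → Set
λN≤ {N} Γ R = Σ (Fin N → ZVec N) λ v → LinIndep v × (∀ i → v i ∈L Γ)
               × (∀ i → toℚ (normSq (v i)) ℚ.≤ R ℚ.* R)

-- Let N = m + 1 and let a = (t, a₁, …, a_m) with t = N D + s, |aᵢ| ≤ D and ‖a‖² < 2 s².
-- The rotations rotʲ a form a strongly diagonally dominant circulant basis: in
-- x = Σ cⱼ rotʲ a the coordinate where |cⱼ| is largest has size ≥ s · max |cⱼ|, and every
-- coordinate with cᵢ ≠ 0 has size ≥ s when max |cⱼ| = 1.  So every lattice vector other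
-- than 0 and ±rotʲ a has squared norm ≥ 2 s² > ‖a‖²: the lattice is cyclic, its minimal
-- vectors are the ±rotʲ a (so it is WR′ with λ_N = ‖a‖), and it determines a.  Letting
-- s − 3 N D and the aᵢ each range over D values gives D^N distinct lattices with
-- λ_N ≤ 6 N D, and D ≈ R / 6N yields at least (12 N)^{-N} R^N of them.
module Submission where

open import Defs
open import Data.Nat using (ℕ; _≤_)
open import Data.Fin using (Fin)
open import Data.Rational using (ℚ; 0ℚ; _*_) renaming (_≤_ to _≤ℚ_; _<_ to _<ℚ_)
open import Data.Product using (Σ; _×_)
open import Relation.Binary.PropositionalEquality using (_≢_)
open import Relation.Nullary using (¬_)

open import Data.Nat as ℕ using (zero; suc; z≤n; s≤s; _<_; _<?_; _^_)
open import Data.Nat.DivMod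
  using (_/_; _%_; m%n<n; m/n/o≡m/[n*o]; m≡m%n+[m/n]*n; n/1≡n; m<n*o⇒m/o<n; m/n*n≤m; m≥n⇒m/n>0)
import Data.Nat.Coprimality as Coprime
import Data.Nat.Properties as ℕP
open import Data.Integer as ℤ using (ℤ; +_; -[1+_]; ∣_∣)
import Data.Integer.Properties as ℤP
open import Data.Fin as Fin using (zero; suc; toℕ; fromℕ; fromℕ<; inject₁; punchIn)
import Data.Fin.Properties as FinP
import Data.Rational as ℚ
open import Data.Rational using (1ℚ)
import Data.Rational.Properties as ℚP
open import Data.Vec using (Vec; []; _∷_; lookup; last; init; tabulate)
import Data.Vec.Properties as VecP
open import Data.Product using (_,_; ∃; proj₁; proj₂)
open import Data.Sum using (_⊎_; inj₁; inj₂; [_,_]) renaming (map to ⊎-map)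
open import Data.Empty using (⊥-elim)
open import Relation.Binary.PropositionalEquality
  using (_≡_; refl; sym; trans; cong; cong₂; subst; subst₂; module ≡-Reasoning)
open import Relation.Nullary using (yes; no; _⊎-dec_)
open import Function using (id; _∘_)
open import Function.Bundles using (mk⇔; Equivalence)
open import Data.Nat.Tactic.RingSolver using (solve-∀)
import Algebra.Properties.Semiring.Sum as Sum
module ℤΣ = Sum ℤP.+-*-semiring
module ℕΣ = Sum ℕP.+-*-semiring

private
  variable
    m n k : ℕ

lookup-ext : {u v : ZVec n} → (∀ i → lookup u i ≡ lookup v i) → u ≡ v
lookup-ext {u = u} {v} u≗v =
  trans (sym (VecP.tabulate∘lookup u)) (trans (VecP.tabulate-cong u≗v) (VecP.tabulate∘lookup v))

lookup-+v : (u v : ZVec n) (i : Fin n) → lookup (u +v v) i ≡ lookup u i ℤ.+ lookup v i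
lookup-+v u v i = VecP.lookup-zipWith ℤ._+_ i u v

lookup-·v : ∀ c (v : ZVec n) (i : Fin n) → lookup (c ·v v) i ≡ c ℤ.* lookup v i
lookup-·v c v i = VecP.lookup-map i (c ℤ.*_) v

lookup-0v : (i : Fin n) → lookup (0v {n}) i ≡ + 0
lookup-0v i = VecP.lookup-replicate i (+ 0)

lookup-lincomb : ∀ (c : Fin k → ℤ) (v : Fin k → ZVec n) (i : Fin n) →
                 lookup (lincomb c v) i ≡ ℤΣ.sum (λ j → c j ℤ.* lookup (v j) i)
lookup-lincomb {zero}  c v i = lookup-0v i
lookup-lincomb {suc k} c v i = trans (lookup-+v (c zero ·v v zero) (lincomb c′ v′) i)
  (cong₂ ℤ._+_ (lookup-·v (c zero) (v zero) i) (lookup-lincomb c′ v′ i))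
  where
  c′ = λ j → c (suc j)
  v′ = λ j → v (suc j)

lincomb-+ : ∀ (c d : Fin k → ℤ) (v : Fin k → ZVec n) →
            lincomb c v +v lincomb d v ≡ lincomb (λ j → c j ℤ.+ d j) v
lincomb-+ c d v = lookup-ext λ i → begin
  lookup (lincomb c v +v lincomb d v) i
    ≡⟨ lookup-+v (lincomb c v) (lincomb d v) i ⟩
  lookup (lincomb c v) i ℤ.+ lookup (lincomb d v) i
    ≡⟨ cong₂ ℤ._+_ (lookup-lincomb c v i) (lookup-lincomb d v i) ⟩
  ℤΣ.sum (λ j → c j ℤ.* lookup (v j) i) ℤ.+ ℤΣ.sum (λ j → d j ℤ.* lookup (v j) i)
    ≡⟨ sym (ℤΣ.∑-distrib-+ (λ j → c j ℤ.* lookup (v j) i) (λ j → d j ℤ.* lookup (v j) i)) ⟩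
  ℤΣ.sum (λ j → c j ℤ.* lookup (v j) i ℤ.+ d j ℤ.* lookup (v j) i)
    ≡⟨ ℤΣ.sum-cong-≗ (λ j → sym (ℤP.*-distribʳ-+ (lookup (v j) i) (c j) (d j))) ⟩
  ℤΣ.sum (λ j → (c j ℤ.+ d j) ℤ.* lookup (v j) i)
    ≡⟨ sym (lookup-lincomb (λ j → c j ℤ.+ d j) v i) ⟩
  lookup (lincomb (λ j → c j ℤ.+ d j) v) i ∎
  where open ≡-Reasoning

lincomb-* : ∀ s (c : Fin k → ℤ) (v : Fin k → ZVec n) →
            s ·v lincomb c v ≡ lincomb (λ j → s ℤ.* c j) v
lincomb-* s c v = lookup-ext λ i → begin
  lookup (s ·v lincomb c v) i                  ≡⟨ lookup-·v s (lincomb c v) i ⟩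
  s ℤ.* lookup (lincomb c v) i                 ≡⟨ cong (s ℤ.*_) (lookup-lincomb c v i) ⟩
  s ℤ.* ℤΣ.sum (λ j → c j ℤ.* lookup (v j) i)  ≡⟨ ℤΣ.*-distribˡ-sum s (λ j → c j ℤ.* lookup (v j) i) ⟩
  ℤΣ.sum (λ j → s ℤ.* (c j ℤ.* lookup (v j) i))
    ≡⟨ ℤΣ.sum-cong-≗ (λ j → sym (ℤP.*-assoc s (c j) (lookup (v j) i))) ⟩
  ℤΣ.sum (λ j → s ℤ.* c j ℤ.* lookup (v j) i)  ≡⟨ sym (lookup-lincomb (λ j → s ℤ.* c j) v i) ⟩
  lookup (lincomb (λ j → s ℤ.* c j) v) i ∎
  where open ≡-Reasoning

lincomb-zero : ∀ (c : Fin k → ℤ) (v : Fin k → ZVec n) → (∀ j → c j ≡ + 0) → lincomb c v ≡ 0v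
lincomb-zero {k} c v c≡0 = lookup-ext λ i → begin
  lookup (lincomb c v) i                ≡⟨ lookup-lincomb c v i ⟩
  ℤΣ.sum (λ j → c j ℤ.* lookup (v j) i) ≡⟨ ℤΣ.sum-cong-≗ (λ j → cong (ℤ._* lookup (v j) i) (c≡0 j)) ⟩
  ℤΣ.sum {k} (λ _ → + 0)               ≡⟨ ℤΣ.sum-replicate-zero k ⟩
  + 0                                   ≡⟨ sym (lookup-0v i) ⟩
  lookup 0v i ∎
  where open ≡-Reasoning

sum-single : ∀ (f : Fin (suc k) → ℤ) i → (∀ j → j ≢ i → f j ≡ + 0) → ℤΣ.sum f ≡ f i
sum-single {k} f i f≡0 = begin
  ℤΣ.sum f                                     ≡⟨ ℤΣ.sum-remove {i = i} f ⟩
  f i ℤ.+ ℤΣ.sum (λ j → f (punchIn i j))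
    ≡⟨ cong (λ z → f i ℤ.+ z) (ℤΣ.sum-cong-≗ λ j → f≡0 _ (FinP.punchInᵢ≢i i j)) ⟩
  f i ℤ.+ ℤΣ.sum {k} (λ _ → + 0)               ≡⟨ cong (λ z → f i ℤ.+ z) (ℤΣ.sum-replicate-zero k) ⟩
  f i ℤ.+ + 0                                  ≡⟨ ℤP.+-identityʳ (f i) ⟩
  f i ∎
  where open ≡-Reasoning

lincomb-single : ∀ (c : Fin (suc k) → ℤ) (v : Fin (suc k) → ZVec n) i →
                 (∀ j → j ≢ i → c j ≡ + 0) → lincomb c v ≡ c i ·v v i
lincomb-single c v i c≡0 = lookup-ext λ l → begin
  lookup (lincomb c v) l                  ≡⟨ lookup-lincomb c v l ⟩
  ℤΣ.sum (λ j → c j ℤ.* lookup (v j) l)   ≡⟨ sum-single _ i (λ j j≢i → cong (ℤ._* lookup (v j) l) (c≡0 j j≢i)) ⟩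
  c i ℤ.* lookup (v i) l                  ≡⟨ sym (lookup-·v (c i) (v i) l) ⟩
  lookup (c i ·v v i) l ∎
  where open ≡-Reasoning

lincomb-cong : ∀ (c : Fin k → ℤ) {v w : Fin k → ZVec n} → (∀ j → v j ≡ w j) → lincomb c v ≡ lincomb c w
lincomb-cong c {v} {w} v≗w = lookup-ext λ i →
  trans (lookup-lincomb c v i)
        (trans (ℤΣ.sum-cong-≗ (λ j → cong (λ z → c j ℤ.* lookup z i) (v≗w j))) (sym (lookup-lincomb c w i)))

·v-identityˡ : (v : ZVec n) → (+ 1) ·v v ≡ v
·v-identityˡ v = lookup-ext λ i → trans (lookup-·v (+ 1) v i) (ℤP.*-identityˡ (lookup v i))

unitCoeff : Fin (suc k) → Fin (suc k) → ℤ
unitCoeff i j with j Fin.≟ i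
... | yes _ = + 1
... | no  _ = + 0

lincomb-unitCoeff : ∀ (v : Fin (suc k) → ZVec n) i → lincomb (unitCoeff i) v ≡ v i
lincomb-unitCoeff v i = begin
  lincomb (unitCoeff i) v  ≡⟨ lincomb-single (unitCoeff i) v i off ⟩
  unitCoeff i i ·v v i     ≡⟨ cong (_·v v i) on ⟩
  (+ 1) ·v v i             ≡⟨ ·v-identityˡ (v i) ⟩
  v i ∎
  where
  open ≡-Reasoning
  off : ∀ j → j ≢ i → unitCoeff i j ≡ + 0
  off j j≢i with j Fin.≟ i
  ... | yes j≡i = ⊥-elim (j≢i j≡i)
  ... | no  _   = refl
  on : unitCoeff i i ≡ + 1
  on with i Fin.≟ i
  ... | yes _   = refl
  ... | no  i≢i = ⊥-elim (i≢i refl)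

∈L-+ : ∀ {Γ : FRLattice n} {x y} → x ∈L Γ → y ∈L Γ → (x +v y) ∈L Γ
∈L-+ {Γ = Γ} (c , refl) (d , refl) = _ , lincomb-+ c d (basis Γ)

∈L-· : ∀ {Γ : FRLattice n} s {x} → x ∈L Γ → (s ·v x) ∈L Γ
∈L-· {Γ = Γ} s (c , refl) = _ , lincomb-* s c (basis Γ)

0v-∈L : ∀ {Γ : FRLattice n} → 0v ∈L Γ
0v-∈L {Γ = Γ} = (λ _ → + 0) , sym (lincomb-zero _ (basis Γ) (λ _ → refl))

lincomb-∈L : ∀ {Γ : FRLattice n} (c : Fin k → ℤ) (w : Fin k → ZVec n) →
             (∀ j → w j ∈L Γ) → lincomb c w ∈L Γ
lincomb-∈L {k = zero}  {Γ} c w w∈Γ = 0v-∈L {Γ = Γ}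
lincomb-∈L {k = suc k} {Γ} c w w∈Γ =
  ∈L-+ {Γ = Γ} (∈L-· {Γ = Γ} (c zero) (w∈Γ zero))
               (lincomb-∈L {Γ = Γ} (λ j → c (suc j)) (λ j → w (suc j)) (λ j → w∈Γ (suc j)))

basis-∈L : ∀ (Γ : FRLattice (suc n)) j → basis Γ j ∈L Γ
basis-∈L Γ j = unitCoeff j , sym (lincomb-unitCoeff (basis Γ) j)

-- Rotation

prev : Fin (suc m) → Fin (suc m)
prev zero    = fromℕ _
prev (suc i) = inject₁ i

lookup-last : ∀ {A : Set} (v : Vec A (suc m)) → last v ≡ lookup v (fromℕ m)
lookup-last (x ∷ [])    = refl
lookup-last (x ∷ y ∷ v) = lookup-last (y ∷ v)

lookup-init : ∀ {A : Set} (v : Vec A (suc m)) i → lookup (init v) i ≡ lookup v (inject₁ i)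
lookup-init (x ∷ y ∷ v) zero    = refl
lookup-init (x ∷ y ∷ v) (suc i) = lookup-init (y ∷ v) i

lookup-rot : ∀ (v : ZVec (suc m)) i → lookup (rot v) i ≡ lookup v (prev i)
lookup-rot v zero    = lookup-last v
lookup-rot v (suc i) = lookup-init v i

rot-lincomb : ∀ (c : Fin k → ℤ) (v : Fin k → ZVec (suc m)) →
              rot (lincomb c v) ≡ lincomb c (λ j → rot (v j))
rot-lincomb c v = lookup-ext λ i → begin
  lookup (rot (lincomb c v)) i                    ≡⟨ lookup-rot (lincomb c v) i ⟩
  lookup (lincomb c v) (prev i)                   ≡⟨ lookup-lincomb c v (prev i) ⟩
  ℤΣ.sum (λ j → c j ℤ.* lookup (v j) (prev i))    ≡⟨ ℤΣ.sum-cong-≗ (λ j → cong (c j ℤ.*_) (sym (lookup-rot (v j) i))) ⟩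
  ℤΣ.sum (λ j → c j ℤ.* lookup (rot (v j)) i)     ≡⟨ sym (lookup-lincomb c (λ j → rot (v j)) i) ⟩
  lookup (lincomb c (λ j → rot (v j))) i ∎
  where open ≡-Reasoning

rotⁿ : ℕ → ZVec n → ZVec n
rotⁿ zero    v = v
rotⁿ (suc k) v = rot (rotⁿ k v)

CyclicShift : ∀ {m} → ℕ → Fin (suc m) → Fin (suc m) → Set
CyclicShift {m} n j i = ∃ λ q → toℕ j ℕ.+ n ≡ toℕ i ℕ.+ q ℕ.* suc m

cyclicShift-zero : ∀ {i j : Fin (suc m)} → CyclicShift 0 j i → j ≡ i
cyclicShift-zero {i = i} {j} (zero , e) =
  FinP.toℕ-injective (trans (sym (ℕP.+-identityʳ (toℕ j))) (trans e (ℕP.+-identityʳ (toℕ i))))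
cyclicShift-zero {m} {i = i} {j} (suc q , e) = ⊥-elim (ℕP.<⇒≱ (FinP.toℕ<n j) (begin
  suc m                                ≤⟨ ℕP.m≤n+m (suc m) (toℕ i) ⟩
  toℕ i ℕ.+ suc m                      ≤⟨ ℕP.+-monoʳ-≤ (toℕ i) (ℕP.m≤m+n (suc m) (q ℕ.* suc m)) ⟩
  toℕ i ℕ.+ suc q ℕ.* suc m            ≡⟨ sym e ⟩
  toℕ j ℕ.+ 0                          ≡⟨ ℕP.+-identityʳ (toℕ j) ⟩
  toℕ j ∎))
  where open ℕP.≤-Reasoning

cyclicShift-prev : ∀ {n} {i j : Fin (suc m)} → CyclicShift (suc n) j i → CyclicShift n j (prev i)
cyclicShift-prev {m} {n} {zero} {j} (zero , e) = ⊥-elim (ℕP.0≢1+n (sym (trans (sym (ℕP.+-suc (toℕ j) n)) e)))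
cyclicShift-prev {m} {n} {zero} {j} (suc q , e) = q ,
  subst (λ z → toℕ j ℕ.+ n ≡ z ℕ.+ q ℕ.* suc m) (sym (FinP.toℕ-fromℕ m))
        (ℕP.suc-injective (trans (sym (ℕP.+-suc (toℕ j) n)) e))
cyclicShift-prev {m} {n} {suc i} {j} (q , e) = q ,
  subst (λ z → toℕ j ℕ.+ n ≡ z ℕ.+ q ℕ.* suc m) (sym (FinP.toℕ-inject₁ i))
        (ℕP.suc-injective (trans (sym (ℕP.+-suc (toℕ j) n)) e))

lookup-rotⁿ : ∀ n (v : ZVec (suc m)) {i j} → CyclicShift n j i → lookup (rotⁿ n v) i ≡ lookup v j
lookup-rotⁿ zero    v shift = cong (lookup v) (sym (cyclicShift-zero shift))
lookup-rotⁿ (suc n) v {i} shift =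
  trans (lookup-rot (rotⁿ n v) i) (lookup-rotⁿ n v (cyclicShift-prev shift))

rotⁿ-period : ∀ (v : ZVec (suc m)) → rotⁿ (suc m) v ≡ v
rotⁿ-period {m} v = lookup-ext λ i →
  lookup-rotⁿ (suc m) v (1 , cong (toℕ i ℕ.+_) (sym (ℕP.+-identityʳ (suc m))))

lookup-rotⁿ-diagonal : ∀ (v : ZVec (suc m)) i → lookup (rotⁿ (toℕ i) v) i ≡ lookup v zero
lookup-rotⁿ-diagonal v i = lookup-rotⁿ (toℕ i) v (0 , sym (ℕP.+-identityʳ (toℕ i)))

lookup-rotⁿ-offDiagonal : ∀ (P : ℤ → Set) (v : ZVec (suc m)) → (∀ j → j ≢ zero → P (lookup v j)) →
                          ∀ n → n < suc m → ∀ i → toℕ i ≢ n → P (lookup (rotⁿ n v) i)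
lookup-rotⁿ-offDiagonal P v Pv zero    _   i i≢0 = Pv i (λ { refl → i≢0 refl })
lookup-rotⁿ-offDiagonal {m} P v Pv (suc n) n<N i i≢n =
  subst P (sym (lookup-rot (rotⁿ n v) i))
        (lookup-rotⁿ-offDiagonal P v Pv n (ℕP.<-trans (ℕP.n<1+n n) n<N) (prev i) (prev≢ i i≢n))
  where
  prev≢ : ∀ i → toℕ i ≢ suc n → toℕ (prev i) ≢ n
  prev≢ zero    _   e = ℕP.<-irrefl (sym (trans (sym (FinP.toℕ-fromℕ m)) e)) (ℕP.≤-pred n<N)
  prev≢ (suc i) i≢n e = i≢n (cong suc (trans (sym (FinP.toℕ-inject₁ i)) e))

sq : ℤ → ℕ
sq x = ∣ x ∣ ℕ.* ∣ x ∣

‖_‖² : ZVec n → ℕ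
‖ [] ‖²    = 0
‖ x ∷ v ‖² = sq x ℕ.+ ‖ v ‖²

x*x≡sq : ∀ x → x ℤ.* x ≡ + sq x
x*x≡sq (+ n)    = sym (ℤP.pos-* n n)
x*x≡sq -[1+ n ] = refl

normSq≡‖‖² : (v : ZVec n) → normSq v ≡ + ‖ v ‖²
normSq≡‖‖² []      = refl
normSq≡‖‖² (x ∷ v) = trans (cong₂ ℤ._+_ (x*x≡sq x) (normSq≡‖‖² v)) (sym (ℤP.pos-+ (sq x) ‖ v ‖²))

‖0v‖² : ‖ 0v {n} ‖² ≡ 0
‖0v‖² {zero}  = refl
‖0v‖² {suc n} = ‖0v‖² {n}

‖v‖²≡‖init‖²+sq-last : (v : ZVec (suc n)) → ‖ v ‖² ≡ ‖ init v ‖² ℕ.+ sq (last v)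
‖v‖²≡‖init‖²+sq-last (x ∷ [])    = ℕP.+-comm (sq x) 0
‖v‖²≡‖init‖²+sq-last (x ∷ y ∷ v) =
  trans (cong (sq x ℕ.+_) (‖v‖²≡‖init‖²+sq-last (y ∷ v))) (sym (ℕP.+-assoc (sq x) _ _))

‖rot‖² : (v : ZVec n) → ‖ rot v ‖² ≡ ‖ v ‖²
‖rot‖² []          = refl
‖rot‖² v@(_ ∷ _) = trans (ℕP.+-comm (sq (last v)) ‖ init v ‖²) (sym (‖v‖²≡‖init‖²+sq-last v))

‖rotⁿ‖² : ∀ k (v : ZVec n) → ‖ rotⁿ k v ‖² ≡ ‖ v ‖²
‖rotⁿ‖² zero    v = refl
‖rotⁿ‖² (suc k) v = trans (‖rot‖² (rotⁿ k v)) (‖rotⁿ‖² k v)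

∣-1*i∣≡∣i∣ : ∀ i → ∣ -[1+ 0 ] ℤ.* i ∣ ≡ ∣ i ∣
∣-1*i∣≡∣i∣ i = trans (cong ∣_∣ (ℤP.-1*i≡-i i)) (ℤP.∣-i∣≡∣i∣ i)

‖-v‖² : (v : ZVec n) → ‖ -[1+ 0 ] ·v v ‖² ≡ ‖ v ‖²
‖-v‖² []      = refl
‖-v‖² (x ∷ v) = cong₂ ℕ._+_ (cong (λ z → z ℕ.* z) (∣-1*i∣≡∣i∣ x)) (‖-v‖² v)

sq-lookup≤‖‖² : (v : ZVec n) (i : Fin n) → sq (lookup v i) ≤ ‖ v ‖²
sq-lookup≤‖‖² (x ∷ v) zero    = ℕP.m≤m+n (sq x) ‖ v ‖²
sq-lookup≤‖‖² (x ∷ v) (suc i) = ℕP.≤-trans (sq-lookup≤‖‖² v i) (ℕP.m≤n+m ‖ v ‖² (sq x))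

sq-lookup₂≤‖‖² : (v : ZVec n) (i j : Fin n) → i ≢ j → sq (lookup v i) ℕ.+ sq (lookup v j) ≤ ‖ v ‖²
sq-lookup₂≤‖‖² (x ∷ v) zero    zero    i≢j = ⊥-elim (i≢j refl)
sq-lookup₂≤‖‖² (x ∷ v) zero    (suc j) _   = ℕP.+-monoʳ-≤ (sq x) (sq-lookup≤‖‖² v j)
sq-lookup₂≤‖‖² (x ∷ v) (suc i) zero    _   =
  ℕP.≤-trans (ℕP.≤-reflexive (ℕP.+-comm (sq (lookup v i)) (sq x))) (ℕP.+-monoʳ-≤ (sq x) (sq-lookup≤‖‖² v i))
sq-lookup₂≤‖‖² (x ∷ v) (suc i) (suc j) i≢j =
  ℕP.≤-trans (sq-lookup₂≤‖‖² v i j (λ i≡j → i≢j (cong suc i≡j))) (ℕP.m≤n+m ‖ v ‖² (sq x))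

‖‖²≤-bounded : ∀ D (v : ZVec n) → (∀ i → ∣ lookup v i ∣ ≤ D) → ‖ v ‖² ≤ n ℕ.* (D ℕ.* D)
‖‖²≤-bounded D []      _  = z≤n
‖‖²≤-bounded D (x ∷ v) v≤ =
  ℕP.+-mono-≤ (ℕP.*-mono-≤ (v≤ zero) (v≤ zero)) (‖‖²≤-bounded D v (λ i → v≤ (suc i)))

-- Diagonal dominance

∣i∣≤∣i+j∣+∣j∣ : ∀ i j → ∣ i ∣ ≤ ∣ i ℤ.+ j ∣ ℕ.+ ∣ j ∣
∣i∣≤∣i+j∣+∣j∣ i j = subst (λ z → ∣ z ∣ ≤ ∣ i ℤ.+ j ∣ ℕ.+ ∣ j ∣) i+j-j≡i (ℤP.∣i-j∣≤∣i∣+∣j∣ (i ℤ.+ j) j)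
  where
  i+j-j≡i : i ℤ.+ j ℤ.- j ≡ i
  i+j-j≡i = trans (ℤP.+-assoc i j (ℤ.- j)) (trans (cong (λ z → i ℤ.+ z) (ℤP.+-inverseʳ j)) (ℤP.+-identityʳ i))

∣∑∣≤∑∣∣ : (f : Fin k → ℤ) → ∣ ℤΣ.sum f ∣ ≤ ℕΣ.sum (λ j → ∣ f j ∣)
∣∑∣≤∑∣∣ {zero}  f = z≤n
∣∑∣≤∑∣∣ {suc k} f = ℕP.≤-trans (ℤP.∣i+j∣≤∣i∣+∣j∣ (f zero) _) (ℕP.+-monoʳ-≤ ∣ f zero ∣ (∣∑∣≤∑∣∣ (λ j → f (suc j))))

∑-mono-≤ : {f g : Fin k → ℕ} → (∀ j → f j ≤ g j) → ℕΣ.sum f ≤ ℕΣ.sum g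
∑-mono-≤ {zero}  f≤g = z≤n
∑-mono-≤ {suc k} f≤g = ℕP.+-mono-≤ (f≤g zero) (∑-mono-≤ (λ j → f≤g (suc j)))

∑≤k*max : (f : Fin k → ℕ) (M : ℕ) → (∀ j → f j ≤ M) → ℕΣ.sum f ≤ k ℕ.* M
∑≤k*max {zero}  f M f≤M = z≤n
∑≤k*max {suc k} f M f≤M = ℕP.+-mono-≤ (f≤M zero) (∑≤k*max (λ j → f (suc j)) M (λ j → f≤M (suc j)))

rowDominance : ∀ (c e : Fin (suc k) → ℤ) D t i → e i ≡ + t → (∀ j → j ≢ i → ∣ e j ∣ ≤ D) →
               t ℕ.* ∣ c i ∣ ≤ ∣ ℤΣ.sum (λ j → c j ℤ.* e j) ∣ ℕ.+ D ℕ.* ℕΣ.sum (λ j → ∣ c j ∣)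
rowDominance c e D t i eᵢ≡t off = begin
  t ℕ.* ∣ c i ∣                   ≡⟨ ℕP.*-comm t ∣ c i ∣ ⟩
  ∣ c i ∣ ℕ.* t                   ≡⟨ cong (λ z → ∣ c i ∣ ℕ.* ∣ z ∣) (sym eᵢ≡t) ⟩
  ∣ c i ∣ ℕ.* ∣ e i ∣             ≡⟨ sym (ℤP.abs-* (c i) (e i)) ⟩
  ∣ f i ∣                         ≤⟨ ∣i∣≤∣i+j∣+∣j∣ (f i) rest ⟩
  ∣ f i ℤ.+ rest ∣ ℕ.+ ∣ rest ∣   ≡⟨ cong (λ z → ∣ z ∣ ℕ.+ ∣ rest ∣) (sym (ℤΣ.sum-remove {i = i} f)) ⟩
  ∣ ℤΣ.sum f ∣ ℕ.+ ∣ rest ∣       ≤⟨ ℕP.+-monoʳ-≤ ∣ ℤΣ.sum f ∣ rest-bound ⟩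
  ∣ ℤΣ.sum f ∣ ℕ.+ D ℕ.* ℕΣ.sum (λ j → ∣ c j ∣) ∎
  where
  open ℕP.≤-Reasoning
  f = λ j → c j ℤ.* e j
  rest = ℤΣ.sum (λ j → f (punchIn i j))
  term-bound : ∀ j → ∣ f (punchIn i j) ∣ ≤ D ℕ.* ∣ c (punchIn i j) ∣
  term-bound j = let j′ = punchIn i j in begin
    ∣ c j′ ℤ.* e j′ ∣       ≡⟨ ℤP.abs-* (c j′) (e j′) ⟩
    ∣ c j′ ∣ ℕ.* ∣ e j′ ∣   ≤⟨ ℕP.*-monoʳ-≤ ∣ c j′ ∣ (off j′ (FinP.punchInᵢ≢i i j)) ⟩
    ∣ c j′ ∣ ℕ.* D          ≡⟨ ℕP.*-comm ∣ c j′ ∣ D ⟩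
    D ℕ.* ∣ c j′ ∣ ∎
  rest-bound : ∣ rest ∣ ≤ D ℕ.* ℕΣ.sum (λ j → ∣ c j ∣)
  rest-bound = begin
    ∣ rest ∣                                            ≤⟨ ∣∑∣≤∑∣∣ (λ j → f (punchIn i j)) ⟩
    ℕΣ.sum (λ j → ∣ f (punchIn i j) ∣)                  ≤⟨ ∑-mono-≤ term-bound ⟩
    ℕΣ.sum (λ j → D ℕ.* ∣ c (punchIn i j) ∣)            ≡⟨ sym (ℕΣ.*-distribˡ-sum D (λ j → ∣ c (punchIn i j) ∣)) ⟩
    D ℕ.* ℕΣ.sum (λ j → ∣ c (punchIn i j) ∣)            ≤⟨ ℕP.*-monoʳ-≤ D (ℕP.m≤n+m _ ∣ c i ∣) ⟩
    D ℕ.* (∣ c i ∣ ℕ.+ ℕΣ.sum (λ j → ∣ c (punchIn i j) ∣))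
      ≡⟨ cong (D ℕ.*_) (sym (ℕΣ.sum-remove {i = i} (λ j → ∣ c j ∣))) ⟩
    D ℕ.* ℕΣ.sum (λ j → ∣ c j ∣) ∎

∣i∣≡1⇒i≡±1 : ∀ z → ∣ z ∣ ≡ 1 → z ≡ + 1 ⊎ z ≡ -[1+ 0 ]
∣i∣≡1⇒i≡±1 (+ .1)      refl = inj₁ refl
∣i∣≡1⇒i≡±1 -[1+ zero ] refl = inj₂ refl

argmax-∣∣ : (c : Fin (suc k) → ℤ) → Σ (Fin (suc k)) λ i → ∀ j → ∣ c j ∣ ≤ ∣ c i ∣
argmax-∣∣ {zero}  c = zero , λ { zero → ℕP.≤-refl }
argmax-∣∣ {suc k} c with argmax-∣∣ (λ j → c (suc j))
... | i , max with ℕP.≤-total ∣ c zero ∣ ∣ c (suc i) ∣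
...   | inj₁ c₀≤cᵢ = suc i , λ { zero → c₀≤cᵢ ; (suc j) → max j }
...   | inj₂ cᵢ≤c₀ = zero  , λ { zero → ℕP.≤-refl ; (suc j) → ℕP.≤-trans (max j) cᵢ≤c₀ }

cancel-dominance : ∀ X s {c M y} → M ≤ c → (X ℕ.+ s) ℕ.* c ≤ y ℕ.+ X ℕ.* M → s ℕ.* M ≤ y
cancel-dominance X s {c} {M} {y} M≤c bound = ℕP.+-cancelˡ-≤ (X ℕ.* M) (s ℕ.* M) y (begin
  X ℕ.* M ℕ.+ s ℕ.* M   ≤⟨ ℕP.+-mono-≤ (ℕP.*-monoʳ-≤ X M≤c) (ℕP.*-monoʳ-≤ s M≤c) ⟩
  X ℕ.* c ℕ.+ s ℕ.* c   ≡⟨ sym (ℕP.*-distribʳ-+ c X s) ⟩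
  (X ℕ.+ s) ℕ.* c       ≤⟨ bound ⟩
  y ℕ.+ X ℕ.* M         ≡⟨ ℕP.+-comm y (X ℕ.* M) ⟩
  X ℕ.* M ℕ.+ y ∎)
  where open ℕP.≤-Reasoning

-- Circulant lattices

_≡±_ : ZVec n → ZVec n → Set
x ≡± y = x ≡ y ⊎ x ≡ -[1+ 0 ] ·v y

‖±‖² : {x y : ZVec n} → x ≡± y → ‖ x ‖² ≡ ‖ y ‖²
‖±‖² (inj₁ refl) = refl
‖±‖² {y = y} (inj₂ refl) = ‖-v‖² y

record Dominant {m : ℕ} (D s : ℕ) (a : ZVec (suc m)) : Set where
  field
    head≡   : lookup a zero ≡ + (suc m ℕ.* D ℕ.+ s)
    tail≤   : ∀ i → i ≢ zero → ∣ lookup a i ∣ ≤ D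
    ‖a‖²<2s² : ‖ a ‖² < s ℕ.* s ℕ.+ s ℕ.* s

module Circulant {m D s : ℕ} {a : ZVec (suc m)} (dom : Dominant D s a) where

  open Dominant dom

  N t : ℕ
  N = suc m
  t = N ℕ.* D ℕ.+ s

  circ : Fin N → ZVec N
  circ j = rotⁿ (toℕ j) a

  circ-diagonal : ∀ j → lookup (circ j) j ≡ + t
  circ-diagonal j = trans (lookup-rotⁿ-diagonal a j) head≡

  circ-offDiagonal : ∀ j i → i ≢ j → ∣ lookup (circ j) i ∣ ≤ D
  circ-offDiagonal j i i≢j = lookup-rotⁿ-offDiagonal (λ x → ∣ x ∣ ≤ D) a tail≤ (toℕ j) (FinP.toℕ<n j) i
                               (λ e → i≢j (FinP.toℕ-injective e))

  ‖circ‖² : ∀ j → ‖ circ j ‖² ≡ ‖ a ‖²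
  ‖circ‖² j = ‖rotⁿ‖² (toℕ j) a

  1≤s : 1 ≤ s
  1≤s = positive s ‖a‖²<2s²
    where
    positive : ∀ x {y} → y < x ℕ.* x ℕ.+ x ℕ.* x → 1 ≤ x
    positive (suc _) _ = s≤s z≤n

  D<t : D < t
  D<t = ℕP.<-≤-trans (ℕP.m<m+n D 1≤s) (ℕP.+-monoˡ-≤ s (ℕP.m≤m+n D (m ℕ.* D)))

  0<t : 0 < t
  0<t = ℕP.≤-<-trans z≤n D<t

  0<‖a‖² : 0 < ‖ a ‖²
  0<‖a‖² = ℕP.<-≤-trans (ℕP.*-mono-< 0<t 0<t) (subst (λ z → sq z ≤ ‖ a ‖²) head≡ (sq-lookup≤‖‖² a zero))

  module _ (c : Fin N → ℤ) where

    private
      x : ZVec N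
      x = lincomb c circ
      i = proj₁ (argmax-∣∣ c)
      M = ∣ c i ∣

      coordinate-bound : ∀ j → t ℕ.* ∣ c j ∣ ≤ ∣ lookup x j ∣ ℕ.+ N ℕ.* D ℕ.* M
      coordinate-bound j = begin
        t ℕ.* ∣ c j ∣
          ≤⟨ rowDominance c (λ l → lookup (circ l) j) D t j (circ-diagonal j)
                          (λ l l≢j → circ-offDiagonal l j (λ j≡l → l≢j (sym j≡l))) ⟩
        ∣ ℤΣ.sum (λ l → c l ℤ.* lookup (circ l) j) ∣ ℕ.+ D ℕ.* ℕΣ.sum (λ l → ∣ c l ∣)
          ≡⟨ cong (λ z → ∣ z ∣ ℕ.+ D ℕ.* ℕΣ.sum (λ l → ∣ c l ∣)) (sym (lookup-lincomb c circ j)) ⟩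
        ∣ lookup x j ∣ ℕ.+ D ℕ.* ℕΣ.sum (λ l → ∣ c l ∣)
          ≤⟨ ℕP.+-monoʳ-≤ ∣ lookup x j ∣ (ℕP.*-monoʳ-≤ D (∑≤k*max _ M (proj₂ (argmax-∣∣ c)))) ⟩
        ∣ lookup x j ∣ ℕ.+ D ℕ.* (N ℕ.* M)
          ≡⟨ cong (∣ lookup x j ∣ ℕ.+_) (trans (sym (ℕP.*-assoc D N M)) (cong (ℕ._* M) (ℕP.*-comm D N))) ⟩
        ∣ lookup x j ∣ ℕ.+ N ℕ.* D ℕ.* M ∎
        where open ℕP.≤-Reasoning

      s*M≤ : ∀ j → M ≤ ∣ c j ∣ → s ℕ.* M ≤ ∣ lookup x j ∣
      s*M≤ j M≤cⱼ = cancel-dominance (N ℕ.* D) s M≤cⱼ (coordinate-bound j)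

      large : 2 ≤ M → s ℕ.* s ℕ.+ s ℕ.* s ≤ ‖ x ‖²
      large 2≤M = begin
        s ℕ.* s ℕ.+ s ℕ.* s              ≤⟨ ℕP.m≤m+n _ _ ⟩
        (s ℕ.* s ℕ.+ s ℕ.* s) ℕ.+ (s ℕ.* s ℕ.+ s ℕ.* s) ≡⟨ square-double s ⟩
        (s ℕ.* 2) ℕ.* (s ℕ.* 2)          ≤⟨ ℕP.*-mono-≤ s*2≤xᵢ s*2≤xᵢ ⟩
        sq (lookup x i)                  ≤⟨ sq-lookup≤‖‖² x i ⟩
        ‖ x ‖² ∎
        where
        open ℕP.≤-Reasoning
        square-double : ∀ s → (s ℕ.* s ℕ.+ s ℕ.* s) ℕ.+ (s ℕ.* s ℕ.+ s ℕ.* s) ≡ (s ℕ.* 2) ℕ.* (s ℕ.* 2)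
        square-double = solve-∀
        s*2≤xᵢ : s ℕ.* 2 ≤ ∣ lookup x i ∣
        s*2≤xᵢ = ℕP.≤-trans (ℕP.*-monoʳ-≤ s 2≤M) (s*M≤ i ℕP.≤-refl)

      two-nonzero : M ≡ 1 → ∀ j → j ≢ i → c j ≢ + 0 → s ℕ.* s ℕ.+ s ℕ.* s ≤ ‖ x ‖²
      two-nonzero M≡1 j j≢i cⱼ≢0 = ℕP.≤-trans (ℕP.+-mono-≤ (ℕP.*-mono-≤ s≤xᵢ s≤xᵢ) (ℕP.*-mono-≤ s≤xⱼ s≤xⱼ))
                                              (sq-lookup₂≤‖‖² x i j (λ i≡j → j≢i (sym i≡j)))
        where
        s≤ : ∀ l → M ≤ ∣ c l ∣ → s ≤ ∣ lookup x l ∣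
        s≤ l M≤cₗ = subst (_≤ ∣ lookup x l ∣) (trans (cong (s ℕ.*_) M≡1) (ℕP.*-identityʳ s)) (s*M≤ l M≤cₗ)
        s≤xᵢ = s≤ i ℕP.≤-refl
        s≤xⱼ = s≤ j (subst (_≤ ∣ c j ∣) (sym M≡1) (ℕP.n≢0⇒n>0 (λ e → cⱼ≢0 (ℤP.∣i∣≡0⇒i≡0 e))))

      one-nonzero : M ≡ 1 → (∀ j → j ≢ i → c j ≡ + 0) → x ≡± circ i
      one-nonzero M≡1 others≡0 = ⊎-map
        (λ cᵢ≡1  → trans x≡cᵢcircᵢ (trans (cong (_·v circ i) cᵢ≡1) (·v-identityˡ (circ i))))
        (λ cᵢ≡-1 → trans x≡cᵢcircᵢ (cong (_·v circ i) cᵢ≡-1))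
        (∣i∣≡1⇒i≡±1 (c i) M≡1)
        where x≡cᵢcircᵢ = lincomb-single c circ i others≡0

    lincomb-trichotomy : (∀ j → c j ≡ + 0) ⊎ (∃ λ j → lincomb c circ ≡± circ j) ⊎ ‖ a ‖² < ‖ lincomb c circ ‖²
    lincomb-trichotomy with M in M≡
    ... | zero        = inj₁ λ j → ℤP.∣i∣≡0⇒i≡0 (ℕP.n≤0⇒n≡0 (subst (∣ c j ∣ ≤_) M≡ (proj₂ (argmax-∣∣ c) j)))
    ... | suc (suc _) = inj₂ (inj₂ (ℕP.<-≤-trans ‖a‖²<2s² (large (subst (2 ≤_) (sym M≡) (s≤s (s≤s z≤n))))))
    ... | suc zero with FinP.all? (λ j → (j Fin.≟ i) ⊎-dec (c j ℤ.≟ + 0))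
    ...   | yes only-i = inj₂ (inj₁ (i , one-nonzero M≡ (λ j j≢i → [ (λ j≡i → ⊥-elim (j≢i j≡i)) , id ] (only-i j))))
    ...   | no  ¬only-i with FinP.¬∀⟶∃¬ N _ (λ j → (j Fin.≟ i) ⊎-dec (c j ℤ.≟ + 0)) ¬only-i
    ...     | j , ¬j≡i⊎cⱼ≡0 =
      inj₂ (inj₂ (ℕP.<-≤-trans ‖a‖²<2s² (two-nonzero M≡ j (λ e → ¬j≡i⊎cⱼ≡0 (inj₁ e)) (λ e → ¬j≡i⊎cⱼ≡0 (inj₂ e)))))

  circ-indep : LinIndep circ
  circ-indep c x≡0 with lincomb-trichotomy c | trans (cong ‖_‖² x≡0) (‖0v‖² {N})
  ... | inj₁ c≡0              | _      = c≡0
  ... | inj₂ (inj₁ (j , x≡±)) | ‖x‖²≡0 =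
    ⊥-elim (ℕP.<-irrefl (sym (trans (sym (trans (‖±‖² x≡±) (‖circ‖² j))) ‖x‖²≡0)) 0<‖a‖²)
  ... | inj₂ (inj₂ a<x)       | ‖x‖²≡0 = ⊥-elim (ℕP.n≮0 (subst (‖ a ‖² <_) ‖x‖²≡0 a<x))

  L : FRLattice N
  L = record { basis = circ ; indep = circ-indep }

  rot-circ-∈L : ∀ j → rot (circ j) ∈L L
  rot-circ-∈L j with suc (toℕ j) <? N
  ... | yes j+1<N = subst (_∈L L) (cong (λ z → rotⁿ z a) (FinP.toℕ-fromℕ< j+1<N)) (basis-∈L L (fromℕ< j+1<N))
  ... | no  j+1≮N = subst (_∈L L) (sym (trans (cong (λ z → rotⁿ (suc z) a) j≡m) (rotⁿ-period a))) (basis-∈L L zero)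
    where j≡m = ℕP.≤-antisym (ℕP.≤-pred (FinP.toℕ<n j)) (ℕP.≤-pred (ℕP.≮⇒≥ j+1≮N))

  circ-rot-preimage : ∀ j → Σ (ZVec N) λ y → y ∈L L × rot y ≡ circ j
  circ-rot-preimage zero    = circ (fromℕ m) , basis-∈L L (fromℕ m) ,
    trans (cong (λ z → rotⁿ (suc z) a) (FinP.toℕ-fromℕ m)) (rotⁿ-period a)
  circ-rot-preimage (suc j) = circ (inject₁ j) , basis-∈L L (inject₁ j) ,
    cong (λ z → rotⁿ (suc z) a) (FinP.toℕ-inject₁ j)

  cyclic : Cyclic L
  cyclic = rot-∈L , rot-preimage
    where
    rot-∈L : ∀ x → x ∈L L → rot x ∈L L
    rot-∈L x (c , refl) = subst (_∈L L) (sym (rot-lincomb c circ)) (lincomb-∈L {Γ = L} c (rot ∘ circ) rot-circ-∈L)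
    rot-preimage : ∀ x → x ∈L L → ∃ λ y → y ∈L L × rot y ≡ x
    rot-preimage x (c , refl) = lincomb c y , lincomb-∈L {Γ = L} c y (λ j → proj₁ (proj₂ (circ-rot-preimage j))) ,
      trans (rot-lincomb c y) (lincomb-cong c (λ j → proj₂ (proj₂ (circ-rot-preimage j))))
      where y = λ j → proj₁ (circ-rot-preimage j)

  ∈L-trichotomy : ∀ x → x ∈L L → x ≢ 0v → (∃ λ j → x ≡± circ j) ⊎ ‖ a ‖² < ‖ x ‖²
  ∈L-trichotomy x (c , refl) x≢0 with lincomb-trichotomy c
  ... | inj₁ c≡0          = ⊥-elim (x≢0 (lincomb-zero c circ c≡0))
  ... | inj₂ short-or-long = short-or-long

  a≢0v : a ≢ 0v
  a≢0v a≡0 = ℕP.<-irrefl (sym (trans (cong ‖_‖² a≡0) (‖0v‖² {N}))) 0<‖a‖²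

  normSq-circ : ∀ j → normSq (circ j) ≡ + ‖ a ‖²
  normSq-circ j = trans (normSq≡‖‖² (circ j)) (cong +_ (‖circ‖² j))

  minimum : IsMinSq L (+ ‖ a ‖²)
  minimum = (a , basis-∈L L zero , a≢0v , normSq≡‖‖² a) , lower-bound
    where
    lower-bound : ∀ v → v ∈L L → v ≢ 0v → + ‖ a ‖² ℤ.≤ normSq v
    lower-bound v v∈L v≢0 = subst (+ ‖ a ‖² ℤ.≤_) (sym (normSq≡‖‖² v)) (ℤ.+≤+ (a≤v (∈L-trichotomy v v∈L v≢0)))
      where
      a≤v : (∃ λ j → v ≡± circ j) ⊎ ‖ a ‖² < ‖ v ‖² → ‖ a ‖² ≤ ‖ v ‖²
      a≤v (inj₁ (j , v≡±)) = ℕP.≤-reflexive (sym (trans (‖±‖² v≡±) (‖circ‖² j)))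
      a≤v (inj₂ a<v)       = ℕP.<⇒≤ a<v

  wellRounded : WR′ L
  wellRounded = + ‖ a ‖² , minimum , λ x → mk⇔ (to x) (from x)
    where
    to : ∀ x → x ∈L L → InSpanOf (MinVec L (+ ‖ a ‖²)) x
    to x (c , x≡) = N , c , circ , (λ j → basis-∈L L j , normSq-circ j) , x≡
    from : ∀ x → InSpanOf (MinVec L (+ ‖ a ‖²)) x → x ∈L L
    from x (k , c , v , v-min , x≡) = subst (_∈L L) (sym x≡) (lincomb-∈L {Γ = L} c v (proj₁ ∘ v-min))

  λN≤-circ : ∀ R → toℚ (+ ‖ a ‖²) ≤ℚ R * R → λN≤ L R
  λN≤-circ R a≤R = circ , circ-indep , basis-∈L L , λ j → subst (λ z → toℚ z ≤ℚ R * R) (sym (normSq-circ j)) a≤R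

∣lookup∣-± : {x y : ZVec n} → x ≡± y → ∀ i → ∣ lookup x i ∣ ≡ ∣ lookup y i ∣
∣lookup∣-± (inj₁ refl) i = refl
∣lookup∣-± {y = y} (inj₂ refl) i = trans (cong ∣_∣ (lookup-·v -[1+ 0 ] y i)) (∣-1*i∣≡∣i∣ (lookup y i))

+≢-1*+ : ∀ p q → 0 < q → + p ≢ -[1+ 0 ] ℤ.* + q
+≢-1*+ p (suc q) _ ()

generator-∈L : ∀ {m D s s′} {a a′ : ZVec (suc m)} (dom : Dominant D s a) (dom′ : Dominant D s′ a′) →
               a′ ∈L Circulant.L dom → a′ ≡ a ⊎ ‖ a ‖² < ‖ a′ ‖²
generator-∈L {D = D} {a = a} {a′} dom dom′ a′∈L = by-cases (C.∈L-trichotomy a′ a′∈L C′.a≢0v)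
  where
  module C  = Circulant dom
  module C′ = Circulant dom′
  by-cases : (∃ λ j → a′ ≡± C.circ j) ⊎ ‖ a ‖² < ‖ a′ ‖² → a′ ≡ a ⊎ ‖ a ‖² < ‖ a′ ‖²
  by-cases (inj₂ a<a′)                = inj₂ a<a′
  by-cases (inj₁ (zero , inj₁ a′≡a))  = inj₁ a′≡a
  by-cases (inj₁ (zero , inj₂ a′≡-a)) = ⊥-elim (+≢-1*+ C′.t C.t C.0<t (begin
    + C′.t                         ≡⟨ sym (Dominant.head≡ dom′) ⟩
    lookup a′ zero                 ≡⟨ cong (λ v → lookup v zero) a′≡-a ⟩
    lookup (-[1+ 0 ] ·v a) zero    ≡⟨ lookup-·v -[1+ 0 ] a zero ⟩
    -[1+ 0 ] ℤ.* lookup a zero     ≡⟨ cong (-[1+ 0 ] ℤ.*_) (Dominant.head≡ dom) ⟩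
    -[1+ 0 ] ℤ.* + C.t ∎))
    where open ≡-Reasoning
  by-cases (inj₁ (suc j , a′≡±circⱼ)) = ⊥-elim (ℕP.n≮n D (begin-strict
    D                              <⟨ C′.D<t ⟩
    C′.t                           ≡⟨ cong ∣_∣ (sym (Dominant.head≡ dom′)) ⟩
    ∣ lookup a′ zero ∣             ≡⟨ ∣lookup∣-± a′≡±circⱼ zero ⟩
    ∣ lookup (C.circ (suc j)) zero ∣ ≤⟨ C.circ-offDiagonal (suc j) zero (λ ()) ⟩
    D ∎))
    where open ℕP.≤-Reasoning

circulant-injective : ∀ {m D s s′} {a a′ : ZVec (suc m)} (dom : Dominant D s a) (dom′ : Dominant D s′ a′) →
                      SameLattice (Circulant.L dom) (Circulant.L dom′) → a ≡ a′
circulant-injective {a = a} {a′} dom dom′ same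
  with generator-∈L dom dom′ (Equivalence.from (same a′) (basis-∈L (Circulant.L dom′) zero))
     | generator-∈L dom′ dom (Equivalence.to (same a) (basis-∈L (Circulant.L dom) zero))
... | inj₁ a′≡a | _         = sym a′≡a
... | inj₂ _    | inj₁ a≡a′ = a≡a′
... | inj₂ a<a′ | inj₂ a′<a = ⊥-elim (ℕP.<-asym a<a′ a′<a)

-- Base-(d+1) digits

digit : ℕ → ℕ → ℕ → ℕ
digit d k p = ((p / suc d ^ k) {{ℕP.m^n≢0 (suc d) k}}) % suc d

digit< : ∀ d k p → digit d k p < suc d
digit< d k p = m%n<n ((p / suc d ^ k) {{ℕP.m^n≢0 (suc d) k}}) (suc d)

digit-suc : ∀ d k p → digit d (suc k) p ≡ digit d k (p / suc d)
digit-suc d k p = cong (_% suc d)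
  (sym (m/n/o≡m/[n*o] p (suc d) (suc d ^ k) {{_}} {{ℕP.m^n≢0 (suc d) k}} {{ℕP.m^n≢0 (suc d) (suc k)}}))

digits-injective : ∀ d n p q → p < suc d ^ n → q < suc d ^ n →
                   (∀ k → k < n → digit d k p ≡ digit d k q) → p ≡ q
digits-injective d zero    p q (s≤s z≤n) (s≤s z≤n) _ = refl
digits-injective d (suc n) p q p< q< same = begin
  p                                   ≡⟨ m≡m%n+[m/n]*n p (suc d) ⟩
  p % suc d ℕ.+ (p / suc d) ℕ.* suc d ≡⟨ cong₂ (λ r u → r ℕ.+ u ℕ.* suc d) same-last same-rest ⟩
  q % suc d ℕ.+ (q / suc d) ℕ.* suc d ≡⟨ sym (m≡m%n+[m/n]*n q (suc d)) ⟩
  q ∎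
  where
  open ≡-Reasoning
  same-last : p % suc d ≡ q % suc d
  same-last = trans (cong (_% suc d) (sym (n/1≡n p))) (trans (same 0 (s≤s z≤n)) (cong (_% suc d) (n/1≡n q)))
  quotient< : ∀ r → r < suc d ^ suc n → r / suc d < suc d ^ n
  quotient< r r< = m<n*o⇒m/o<n (subst (r <_) (ℕP.*-comm (suc d) (suc d ^ n)) r<)
  same-rest : p / suc d ≡ q / suc d
  same-rest = digits-injective d n (p / suc d) (q / suc d) (quotient< p p<) (quotient< q q<)
    (λ k k<n → trans (sym (digit-suc d k p)) (trans (same (suc k) (s≤s k<n)) (digit-suc d k q)))

-- Lattice p of the family: digit 0 of p shifts s, digits 1 … m are the off-diagonal entries.
module Family (m d : ℕ) where

  N D X : ℕ
  N = suc m
  D = suc d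
  X = N ℕ.* D

  s : ℕ → ℕ
  s p = 3 ℕ.* X ℕ.+ digit d 0 p

  generator : ℕ → ZVec N
  generator p = + (X ℕ.+ s p) ∷ tabulate (λ i → + digit d (suc (toℕ i)) p)

  lookup-generator-suc : ∀ p i → lookup (generator p) (suc i) ≡ + digit d (suc (toℕ i)) p
  lookup-generator-suc p i = VecP.lookup∘tabulate (λ i → + digit d (suc (toℕ i)) p) i

  ∣generator-suc∣≤D : ∀ p i → ∣ lookup (generator p) (suc i) ∣ ≤ D
  ∣generator-suc∣≤D p i =
    subst (λ z → ∣ z ∣ ≤ D) (sym (lookup-generator-suc p i)) (ℕP.<⇒≤ (digit< d (suc (toℕ i)) p))

  ‖generator‖²≤ : ∀ p → ‖ generator p ‖² ≤ (X ℕ.+ s p) ℕ.* (X ℕ.+ s p) ℕ.+ m ℕ.* (D ℕ.* D)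
  ‖generator‖²≤ p = ℕP.+-monoʳ-≤ ((X ℕ.+ s p) ℕ.* (X ℕ.+ s p))
    (‖‖²≤-bounded D (tabulate (λ i → + digit d (suc (toℕ i)) p)) (∣generator-suc∣≤D p))

  dominant : ∀ p → Dominant D (s p) (generator p)
  dominant p = record
    { head≡    = refl
    ; tail≤    = tail≤
    ; ‖a‖²<2s² = ℕP.≤-<-trans (‖generator‖²≤ p) (t²+mD²<2s² (digit d 0 p))
    }
    where
    tail≤ : ∀ i → i ≢ zero → ∣ lookup (generator p) i ∣ ≤ D
    tail≤ zero    0≢0 = ⊥-elim (0≢0 refl)
    tail≤ (suc i) _   = ∣generator-suc∣≤D p i
    2s²-gap : ∀ m d y → let D = suc d; X = suc m ℕ.* D; s = 3 ℕ.* X ℕ.+ y; t = X ℕ.+ s in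
      s ℕ.* s ℕ.+ s ℕ.* s ≡ suc (t ℕ.* t ℕ.+ m ℕ.* (D ℕ.* D))
        ℕ.+ ((d ℕ.* d ℕ.+ 2 ℕ.* d) ℕ.* (2 ℕ.* m ℕ.* m ℕ.+ 3 ℕ.* m ℕ.+ 2) ℕ.+ 2 ℕ.* m ℕ.* m ℕ.+ 3 ℕ.* m ℕ.+ 1
             ℕ.+ 4 ℕ.* X ℕ.* y ℕ.+ y ℕ.* y)
    2s²-gap = solve-∀
    t²+mD²<2s² : ∀ y → let s = 3 ℕ.* X ℕ.+ y; t = X ℕ.+ s in
                  t ℕ.* t ℕ.+ m ℕ.* (D ℕ.* D) < s ℕ.* s ℕ.+ s ℕ.* s
    t²+mD²<2s² y = ℕP.≤-trans (ℕP.m≤m+n _ _) (ℕP.≤-reflexive (sym (2s²-gap m d y)))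

  generator-injective : ∀ p q → p < D ^ N → q < D ^ N → generator p ≡ generator q → p ≡ q
  generator-injective p q p< q< g≡ = digits-injective d N p q p< q< same-digit
    where
    same-digit : ∀ k → k < N → digit d k p ≡ digit d k q
    same-digit zero    _          =
      ℕP.+-cancelˡ-≡ (3 ℕ.* X) _ _ (ℕP.+-cancelˡ-≡ X _ _ (ℤP.+-injective (cong (λ v → lookup v zero) g≡)))
    same-digit (suc k) (s≤s k<m) = ℤP.+-injective (begin
      + digit d (suc k) p               ≡⟨ cong (λ z → + digit d (suc z) p) (sym (FinP.toℕ-fromℕ< k<m)) ⟩
      + digit d (suc (toℕ i)) p         ≡⟨ sym (lookup-generator-suc p i) ⟩
      lookup (generator p) (suc i)      ≡⟨ cong (λ v → lookup v (suc i)) g≡ ⟩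
      lookup (generator q) (suc i)      ≡⟨ lookup-generator-suc q i ⟩
      + digit d (suc (toℕ i)) q         ≡⟨ cong (λ z → + digit d (suc z) q) (FinP.toℕ-fromℕ< k<m) ⟩
      + digit d (suc k) q ∎)
      where
      open ≡-Reasoning
      i = fromℕ< k<m

  ‖generator‖²≤[6X]² : ∀ p → ‖ generator p ‖² ≤ (6 ℕ.* X) ℕ.* (6 ℕ.* X)
  ‖generator‖²≤[6X]² p = begin
    ‖ generator p ‖²                          ≤⟨ ‖generator‖²≤ p ⟩
    (X ℕ.+ s p) ℕ.* (X ℕ.+ s p) ℕ.+ m ℕ.* (D ℕ.* D) ≤⟨ ℕP.+-mono-≤ (ℕP.*-mono-≤ t≤5X t≤5X) mD²≤X² ⟩
    (5 ℕ.* X) ℕ.* (5 ℕ.* X) ℕ.+ X ℕ.* X       ≤⟨ ℕP.m≤m+n _ _ ⟩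
    (5 ℕ.* X) ℕ.* (5 ℕ.* X) ℕ.+ X ℕ.* X ℕ.+ 10 ℕ.* (X ℕ.* X) ≡⟨ square-split X ⟩
    (6 ℕ.* X) ℕ.* (6 ℕ.* X) ∎
    where
    open ℕP.≤-Reasoning
    square-split : ∀ X → (5 ℕ.* X) ℕ.* (5 ℕ.* X) ℕ.+ X ℕ.* X ℕ.+ 10 ℕ.* (X ℕ.* X) ≡ (6 ℕ.* X) ℕ.* (6 ℕ.* X)
    square-split = solve-∀
    five : ∀ X → X ℕ.+ (3 ℕ.* X ℕ.+ X) ≡ 5 ℕ.* X
    five = solve-∀
    t≤5X : X ℕ.+ s p ≤ 5 ℕ.* X
    t≤5X = ℕP.≤-trans (ℕP.+-monoʳ-≤ X (ℕP.+-monoʳ-≤ (3 ℕ.* X)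
             (ℕP.≤-trans (ℕP.<⇒≤ (digit< d 0 p)) (ℕP.m≤n*m D N)))) (ℕP.≤-reflexive (five X))
    square-comm : ∀ N D → N ℕ.* N ℕ.* (D ℕ.* D) ≡ N ℕ.* D ℕ.* (N ℕ.* D)
    square-comm = solve-∀
    mD²≤X² : m ℕ.* (D ℕ.* D) ≤ X ℕ.* X
    mD²≤X² = ℕP.≤-trans (ℕP.*-monoˡ-≤ (D ℕ.* D) (ℕP.≤-trans (ℕP.n≤1+n m) (ℕP.m≤m*n N N)))
                        (ℕP.≤-reflexive (square-comm N D))

  lattice : ℕ → FRLattice N
  lattice p = Circulant.L (dominant p)

  lattice-injective : ∀ p q → p < D ^ N → q < D ^ N → SameLattice (lattice p) (lattice q) → p ≡ q
  lattice-injective p q p< q< same =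
    generator-injective p q p< q< (circulant-injective (dominant p) (dominant q) same)

fromℕℚ≡mkℚ : ∀ n → fromℕℚ n ≡ ℚ.mkℚ (+ n) 0 (Coprime.sym (Coprime.1-coprimeTo n))
fromℕℚ≡mkℚ n = ℚP.normalize-coprime (Coprime.sym (Coprime.1-coprimeTo n))

fromℕℚ-mono-≤ : ∀ {p q} → p ≤ q → fromℕℚ p ≤ℚ fromℕℚ q
fromℕℚ-mono-≤ {p} {q} p≤q rewrite fromℕℚ≡mkℚ p | fromℕℚ≡mkℚ q =
  ℚ.*≤* (subst₂ ℤ._≤_ (sym (ℤP.*-identityʳ (+ p))) (sym (ℤP.*-identityʳ (+ q))) (ℤ.+≤+ p≤q))

fromℕℚ-cancel-≤ : ∀ {p q} → fromℕℚ p ≤ℚ fromℕℚ q → p ≤ q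
fromℕℚ-cancel-≤ {p} {q} p≤q rewrite fromℕℚ≡mkℚ p | fromℕℚ≡mkℚ q =
  ℤP.drop‿+≤+ (subst₂ ℤ._≤_ (ℤP.*-identityʳ (+ p)) (ℤP.*-identityʳ (+ q)) (ℚP.drop-*≤* p≤q))

fromℕℚ-* : ∀ p q → fromℕℚ (p ℕ.* q) ≡ fromℕℚ p * fromℕℚ q
fromℕℚ-* p q rewrite fromℕℚ≡mkℚ p | fromℕℚ≡mkℚ q = cong (ℚ._/ 1) (ℤP.pos-* p q)

fromℕℚ-^ : ∀ p k → fromℕℚ (p ^ k) ≡ fromℕℚ p ^ℚ k
fromℕℚ-^ p zero    = refl
fromℕℚ-^ p (suc k) = trans (fromℕℚ-* p (p ^ k)) (cong (fromℕℚ p *_) (fromℕℚ-^ p k))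

fromℕℚ-nonNeg : ∀ p → 0ℚ ≤ℚ fromℕℚ p
fromℕℚ-nonNeg p = fromℕℚ-mono-≤ {0} {p} z≤n

fromℕℚ-pos : ∀ {p} → 0 < p → 0ℚ <ℚ fromℕℚ p
fromℕℚ-pos {p} 0<p rewrite fromℕℚ≡mkℚ p =
  ℚ.*<* (subst (+ 0 ℤ.<_) (sym (ℤP.*-identityʳ (+ p))) (ℤ.+<+ 0<p))

^ℚ-nonNeg : ∀ x k → 0ℚ ≤ℚ x → 0ℚ ≤ℚ x ^ℚ k
^ℚ-nonNeg x zero    0≤x = ℚP.nonNegative⁻¹ 1ℚ
^ℚ-nonNeg x (suc k) 0≤x = ℚP.≤-trans (ℚP.≤-reflexive (sym (ℚP.*-zeroˡ (x ^ℚ k))))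
  (ℚP.*-monoʳ-≤-nonNeg (x ^ℚ k) {{ℚ.nonNegative (^ℚ-nonNeg x k 0≤x)}} 0≤x)

^ℚ-mono-≤ : ∀ x y k → 0ℚ ≤ℚ x → x ≤ℚ y → x ^ℚ k ≤ℚ y ^ℚ k
^ℚ-mono-≤ x y zero    _   _   = ℚP.≤-refl
^ℚ-mono-≤ x y (suc k) 0≤x x≤y = ℚP.≤-trans
  (ℚP.*-monoʳ-≤-nonNeg (x ^ℚ k) {{ℚ.nonNegative (^ℚ-nonNeg x k 0≤x)}} x≤y)
  (ℚP.*-monoˡ-≤-nonNeg y {{ℚ.nonNegative (ℚP.≤-trans 0≤x x≤y)}} (^ℚ-mono-≤ x y k 0≤x x≤y))

fromℕℚ-square-≤ : ∀ {p} {R} → fromℕℚ p ≤ℚ R → fromℕℚ (p ℕ.* p) ≤ℚ R * R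
fromℕℚ-square-≤ {p} {R} p≤R = begin
  fromℕℚ (p ℕ.* p)        ≡⟨ fromℕℚ-* p p ⟩
  fromℕℚ p * fromℕℚ p     ≤⟨ ℚP.*-monoʳ-≤-nonNeg (fromℕℚ p) {{ℚ.nonNegative (fromℕℚ-nonNeg p)}} p≤R ⟩
  R * fromℕℚ p            ≤⟨ ℚP.*-monoˡ-≤-nonNeg R {{ℚ.nonNegative (ℚP.≤-trans (fromℕℚ-nonNeg p) p≤R)}} p≤R ⟩
  R * R ∎
  where open ℚP.≤-Reasoning

floor-nonNeg : ∀ R → 0ℚ ≤ℚ R → Σ ℕ λ n → fromℕℚ n ≤ℚ R × R ≤ℚ fromℕℚ (suc n)
floor-nonNeg (ℚ.mkℚ -[1+ _ ] _ _) 0≤R with () ← ℚP.drop-*≤* 0≤R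
floor-nonNeg (ℚ.mkℚ (+ a) b-1 a⊥b) _ = q , q≤R , R≤q+1
  where
  b = suc b-1
  q = a / b
  q≤R : fromℕℚ q ≤ℚ ℚ.mkℚ (+ a) b-1 a⊥b
  q≤R rewrite fromℕℚ≡mkℚ q =
    ℚ.*≤* (subst₂ ℤ._≤_ (ℤP.pos-* q b) (sym (ℤP.*-identityʳ (+ a))) (ℤ.+≤+ (m/n*n≤m a b)))
  a≤[q+1]b : a ≤ suc q ℕ.* b
  a≤[q+1]b = ℕP.≤-trans (ℕP.≤-reflexive (m≡m%n+[m/n]*n a b)) (ℕP.+-monoˡ-≤ (q ℕ.* b) (ℕP.<⇒≤ (m%n<n a b)))
  R≤q+1 : ℚ.mkℚ (+ a) b-1 a⊥b ≤ℚ fromℕℚ (suc q)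
  R≤q+1 rewrite fromℕℚ≡mkℚ (suc q) =
    ℚ.*≤* (subst₂ ℤ._≤_ (sym (ℤP.*-identityʳ (+ a))) (ℤP.pos-* (suc q) b) (ℤ.+≤+ a≤[q+1]b))

module _ (p : ℕ) (0<p : 0 < p) where

  private instance
    p-positive : ℚ.Positive (fromℕℚ p)
    p-positive = ℚ.positive (fromℕℚ-pos 0<p)
    p-nonZero : ℚ.NonZero (fromℕℚ p)
    p-nonZero = ℚ.>-nonZero (fromℕℚ-pos 0<p)

  -- Opaque, since otherwise unification unfolds 1 / p and normalises it through gcd.
  opaque
    reciprocal : ℚ
    reciprocal = ℚ.1/ fromℕℚ p

    reciprocal-pos : 0ℚ <ℚ reciprocal
    reciprocal-pos = ℚP.positive⁻¹ reciprocal {{ℚP.1/pos⇒pos (fromℕℚ p)}}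

    reciprocal-inverse : reciprocal * fromℕℚ p ≡ 1ℚ
    reciprocal-inverse = ℚP.*-inverseˡ (fromℕℚ p)

^-distribʳ-* : ∀ p q k → (p ℕ.* q) ^ k ≡ p ^ k ℕ.* q ^ k
^-distribʳ-* p q zero    = refl
^-distribʳ-* p q (suc k) = trans (cong (p ℕ.* q ℕ.*_) (^-distribʳ-* p q k)) (interchange p q (p ^ k) (q ^ k))
  where
  interchange : ∀ p q x y → p ℕ.* q ℕ.* (x ℕ.* y) ≡ p ℕ.* x ℕ.* (q ℕ.* y)
  interchange = solve-∀

power-count : ∀ c N D R .{{_ : ℕ.NonZero c}} → 0ℚ ≤ℚ R → R ≤ℚ fromℕℚ (c ℕ.* D) →
              reciprocal (c ^ N) (ℕP.m^n>0 c N) * R ^ℚ N ≤ℚ fromℕℚ (D ^ N)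
power-count c N D R 0≤R R≤cD = begin
  α * R ^ℚ N                              ≤⟨ ℚP.*-monoˡ-≤-nonNeg α {{ℚP.pos⇒nonNeg α {{ℚ.positive α>0}}}}
                                               (^ℚ-mono-≤ R (fromℕℚ (c ℕ.* D)) N 0≤R R≤cD) ⟩
  α * fromℕℚ (c ℕ.* D) ^ℚ N               ≡⟨ cong (α *_) (sym (fromℕℚ-^ (c ℕ.* D) N)) ⟩
  α * fromℕℚ ((c ℕ.* D) ^ N)              ≡⟨ cong (λ z → α * fromℕℚ z) (^-distribʳ-* c D N) ⟩
  α * fromℕℚ (c ^ N ℕ.* D ^ N)            ≡⟨ cong (α *_) (fromℕℚ-* (c ^ N) (D ^ N)) ⟩
  α * (fromℕℚ (c ^ N) * fromℕℚ (D ^ N))   ≡⟨ sym (ℚP.*-assoc α (fromℕℚ (c ^ N)) (fromℕℚ (D ^ N))) ⟩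
  α * fromℕℚ (c ^ N) * fromℕℚ (D ^ N)     ≡⟨ cong (_* fromℕℚ (D ^ N)) (reciprocal-inverse (c ^ N) (ℕP.m^n>0 c N)) ⟩
  1ℚ * fromℕℚ (D ^ N)                     ≡⟨ ℚP.*-identityˡ (fromℕℚ (D ^ N)) ⟩
  fromℕℚ (D ^ N) ∎
  where
  open ℚP.≤-Reasoning
  α = reciprocal (c ^ N) (ℕP.m^n>0 c N)
  α>0 = reciprocal-pos (c ^ N) (ℕP.m^n>0 c N)

scale-window : ∀ q .{{_ : ℕ.NonZero q}} R → fromℕℚ (2 ℕ.* q) ≤ℚ R →
               Σ ℕ λ d → fromℕℚ (q ℕ.* suc d) ≤ℚ R × R ≤ℚ fromℕℚ (2 ℕ.* q ℕ.* suc d)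
scale-window q R 2q≤R with floor-nonNeg R (ℚP.≤-trans (fromℕℚ-nonNeg (2 ℕ.* q)) 2q≤R)
... | n , n≤R , R≤n+1 = positive-suc D 0<D
  ( ℚP.≤-trans (fromℕℚ-mono-≤ (subst (_≤ n) (ℕP.*-comm D q) (m/n*n≤m n q))) n≤R
  , ℚP.≤-trans R≤n+1 (fromℕℚ-mono-≤ n+1≤2qD))
  where
  positive-suc : ∀ D → 0 < D → fromℕℚ (q ℕ.* D) ≤ℚ R × R ≤ℚ fromℕℚ (2 ℕ.* q ℕ.* D) →
                 Σ ℕ λ d → fromℕℚ (q ℕ.* suc d) ≤ℚ R × R ≤ℚ fromℕℚ (2 ℕ.* q ℕ.* suc d)
  positive-suc (suc d) _ window = d , window
  D = n / q
  q≤n : q ≤ n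
  q≤n = ℕP.≤-pred (begin
    suc q             ≤⟨ ℕP.+-monoˡ-≤ q (ℕP.n≢0⇒n>0 (ℕ.≢-nonZero⁻¹ q)) ⟩
    q ℕ.+ q           ≤⟨ ℕP.+-monoʳ-≤ q (ℕP.m≤m+n q 0) ⟩
    2 ℕ.* q           ≤⟨ fromℕℚ-cancel-≤ (ℚP.≤-trans 2q≤R R≤n+1) ⟩
    suc n ∎)
    where open ℕP.≤-Reasoning
  0<D : 0 < D
  0<D = m≥n⇒m/n>0 q≤n
  n+1≤2qD : suc n ≤ 2 ℕ.* q ℕ.* D
  n+1≤2qD = begin
    suc n                       ≡⟨ cong suc (m≡m%n+[m/n]*n n q) ⟩
    suc (n % q) ℕ.+ D ℕ.* q     ≤⟨ ℕP.+-monoˡ-≤ (D ℕ.* q) (m%n<n n q) ⟩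
    q ℕ.+ D ℕ.* q               ≤⟨ ℕP.+-monoˡ-≤ (D ℕ.* q) (ℕP.m≤n*m q D {{ℕ.>-nonZero 0<D}}) ⟩
    D ℕ.* q ℕ.+ D ℕ.* q         ≡⟨ double D q ⟩
    2 ℕ.* q ℕ.* D ∎
    where
    open ℕP.≤-Reasoning
    double : ∀ D q → D ℕ.* q ℕ.+ D ℕ.* q ≡ 2 ℕ.* q ℕ.* D
    double = solve-∀

WellRoundedFamily : (N : ℕ) → ℚ → ℕ → Set
WellRoundedFamily N R k = Σ (Fin k → FRLattice N) λ Γ →
  (∀ i j → i ≢ j → ¬ SameLattice (Γ i) (Γ j)) × (∀ i → Cyclic (Γ i) × WR′ (Γ i) × λN≤ (Γ i) R)

circulantFamily : ∀ m d R → fromℕℚ (6 ℕ.* suc m ℕ.* suc d) ≤ℚ R → WellRoundedFamily (suc m) R (suc d ^ suc m)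
circulantFamily m d R 6ND≤R = Γ , distinct , properties
  where
  open Family m d
  Γ : Fin (D ^ N) → FRLattice N
  Γ i = lattice (toℕ i)
  distinct : ∀ i j → i ≢ j → ¬ SameLattice (Γ i) (Γ j)
  distinct i j i≢j same = i≢j (FinP.toℕ-injective (lattice-injective _ _ (FinP.toℕ<n i) (FinP.toℕ<n j) same))
  6X≤R : fromℕℚ (6 ℕ.* X) ≤ℚ R
  6X≤R = subst (_≤ℚ R) (cong fromℕℚ (ℕP.*-assoc 6 N D)) 6ND≤R
  properties : ∀ i → Cyclic (Γ i) × WR′ (Γ i) × λN≤ (Γ i) R
  properties i = C.cyclic , C.wellRounded ,
    C.λN≤-circ R (ℚP.≤-trans (fromℕℚ-mono-≤ (‖generator‖²≤[6X]² (toℕ i))) (fromℕℚ-square-≤ {6 ℕ.* X} 6X≤R))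
    where module C = Circulant (dominant (toℕ i))

-- (12 N)^(-N) for N = suc m, with 12 N written as 2 · (6 N) as in scale-window.
density : ℕ → ℚ
density m = reciprocal ((2 ℕ.* (6 ℕ.* suc m)) ^ suc m) (ℕP.m^n>0 (2 ℕ.* (6 ℕ.* suc m)) (suc m))

manyLattices : ∀ m R → fromℕℚ (2 ℕ.* (6 ℕ.* suc m)) ≤ℚ R →
               Σ ℕ λ k → density m * R ^ℚ suc m ≤ℚ fromℕℚ k × WellRoundedFamily (suc m) R k
manyLattices m R 12N≤R =
  let (d , 6ND≤R , R≤12ND) = scale-window (6 ℕ.* suc m) R 12N≤R in
  suc d ^ suc m ,
  power-count (2 ℕ.* (6 ℕ.* suc m)) (suc m) (suc d) R (ℚP.≤-trans (fromℕℚ-nonNeg (2 ℕ.* (6 ℕ.* suc m))) 12N≤R) R≤12ND ,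
  circulantFamily m d R 6ND≤R

theorem1p1 : (N : ℕ) → 2 ≤ N →
    Σ ℚ λ α → (0ℚ <ℚ α) × Σ ℚ λ R₀ → (R : ℚ) → R₀ ≤ℚ R →
      Σ ℕ λ k → (α * (R ^ℚ N) ≤ℚ fromℕℚ k)
        × Σ (Fin k → FRLattice N) λ Γ →
            (∀ i j → i ≢ j → ¬ SameLattice (Γ i) (Γ j))
            × (∀ i → Cyclic (Γ i) × WR′ (Γ i) × λN≤ (Γ i) R)
theorem1p1 (suc m) _ =
  density m , reciprocal-pos _ _ , fromℕℚ (2 ℕ.* (6 ℕ.* suc m)) , manyLattices m
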